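{- Let $\tilde\Sigma$ be a multi-sorted signature with equality whose only non-logical symbols are unary function symbols (in particular, with no constant symbols), and suppose $\tilde\Sigma$ is tree-like. Then the class of finite $\tilde\Sigma$-structures is a well-quasi-order with respect to the embeddability quasi-order ($\mathcal M\le\mathcal N$ iff there is an embedding of $\mathcal M$ into $\mathcal N$).
   Context: The characteristic graph of $\tilde\Sigma$ has the sorts as nodes and an edge $S\to S'$ for each function symbol $f:S\to S'$. $\tilde\Sigma$ is tree-like if this graph is acyclic and every node with at least one outgoing edge has exactly one outgoing edge. An embedding of $\Sigma$-structures is a sort-preserving injective map commuting with the interpretations of the function symbols. A well-quasi-order is a class with a reflexive transitive relation $\le$ such that every infinite sequence $w_0,w_1,\dots$ has $i<j$ with $w_i\le w_j$. -}

module Defs where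

open import Data.Nat using (ℕ; suc; _≤_; _<_)
open import Data.Fin using (Fin)
open import Data.Product using (Σ; ∃; _×_)
open import Relation.Binary.PropositionalEquality using (_≡_)
open import Relation.Nullary using (¬_)
open import Function.Definitions using (Injective)

record Signature : Set where
  field
    nSorts : ℕ
    nFuns  : ℕ
    dom    : Fin nFuns → Fin nSorts
    cod    : Fin nFuns → Fin nSorts
open Signature public

-- Directed paths of positive length in the characteristic graph
-- (one edge dom f → cod f per function symbol f).
data Path⁺ (Σ' : Signature) : Fin (nSorts Σ') → Fin (nSorts Σ') → Set where
  edge : (f : Fin (nFuns Σ')) → Path⁺ Σ' (dom Σ' f) (cod Σ' f)
  _∷_  : (f : Fin (nFuns Σ')) {t : Fin (nSorts Σ')} →
         Path⁺ Σ' (cod Σ' f) t → Path⁺ Σ' (dom Σ' f) t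

Acyclic : Signature → Set
Acyclic Σ' = ∀ s → ¬ Path⁺ Σ' s s

AtMostOneOut : Signature → Set
AtMostOneOut Σ' = ∀ f g → dom Σ' f ≡ dom Σ' g → f ≡ g

TreeLike : Signature → Set
TreeLike Σ' = Acyclic Σ' × AtMostOneOut Σ'

record FinStructure (Σ' : Signature) : Set where
  field
    size     : Fin (nSorts Σ') → ℕ
    nonempty : ∀ s → 1 ≤ size s
    op       : (f : Fin (nFuns Σ')) → Fin (size (dom Σ' f)) → Fin (size (cod Σ' f))
open FinStructure public

record Embedding {Σ' : Signature} (M N : FinStructure Σ') : Set where
  field
    map      : (s : Fin (nSorts Σ')) → Fin (size M s) → Fin (size N s)
    injective : ∀ s → Injective _≡_ _≡_ (map s)
    commutes : ∀ f x → map (cod Σ' f) (op M f x) ≡ op N f (map (dom Σ' f) x)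

EmbeddabilityWQO : Signature → Set
EmbeddabilityWQO Σ' =
  (w : ℕ → FinStructure Σ') → Σ ℕ λ i → Σ ℕ λ j → (i < j) × Embedding (w i) (w j)

{-# OPTIONS --safe #-}
module Submission where

-- As every sort has at most one outgoing function symbol and the characteristic graph is
-- acyclic, the elements of a finite structure form a forest of height at most the number D
-- of sorts: an element hangs below its image under the symbol leaving its sort. Code each
-- element, to depth j, by one list per function symbol of the depth-(j - 1) codes of its
-- children, and compare codes by the sublist order. If the lists of root codes of M embed
-- into those of N, the roots of M can be mapped into N, and then recursively the children
-- of each element among the children of its image: this is an embedding M → N. By Higman's
-- lemma, iterated over the depth and over the finitely many sorts and symbols, the order on
-- these codes is almost full in the inductive sense of Vytiniotis, Coquand and Wahlstedt,
-- which yields the required i < j constructively.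

open import Defs

open import Level using (0ℓ)
open import Data.Bool.Base using (true; T)
open import Data.Fin.Base using (Fin; zero; suc; toℕ; lift)
open import Data.Fin.Properties using (all?; any?; pigeonhole; lift-injective; toℕ-injective; _≟_)
import Data.Fin.Properties as Fin
open import Data.List.Base using (List; []; _∷_; tabulate)
open import Data.List.Relation.Binary.Sublist.Heterogeneous using (Sublist; []; _∷_; _∷ʳ_; minimum)
open import Data.List.Relation.Binary.Sublist.Heterogeneous.Properties using (sublist?; ++⁺; ++ˡ; ++ʳ)
open import Data.List.Relation.Unary.All using (All; []; _∷_)
open import Data.List.Relation.Unary.First using (FirstView; _++_∷_; first)
open import Data.List.Relation.Unary.First.Properties using (toView)
open import Data.Maybe.Base using (Maybe; just; nothing; when)
open import Data.Nat.Base using (ℕ; zero; suc; _+_; _∸_; _≤_; _<_; z≤n; s≤s; z<s; s<s; _≡ᵇ_)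
open import Data.Nat.Properties using (+-suc; m+[n∸m]≡n; n<1+n; suc-injective; ≡ᵇ⇒≡; ≡⇒≡ᵇ)
open import Data.Product.Base using (Σ; ∃; _×_; _,_; proj₁; proj₂)
open import Data.Sum.Base as Sum using (_⊎_; inj₁; inj₂)
open import Data.Unit.Base using (⊤; tt)
open import Data.Vec.Functional using (Vector; head; tail)
open import Data.Vec.Functional.Relation.Binary.Pointwise using (Pointwise)
open import Function.Base using (_∘_; _on_)
open import Function.Definitions using (Injective)
open import Relation.Binary.Core using (Rel; REL; _⇒_)
open import Relation.Binary.Construct.Intersection using (_∩_)
open import Relation.Binary.Definitions using (Decidable)
open import Relation.Binary.PropositionalEquality
  using (_≡_; _≢_; refl; sym; trans; cong; subst; module ≡-Reasoning)
open import Relation.Nullary using (¬_; Dec; yes; no; contradiction)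
open import Relation.Nullary.Decidable using (_⊎-dec_; _×-dec_; toSum)
open import Relation.Unary using (Pred; ∁)

private
  variable
    A B X Y : Set
    R S U V : Rel X 0ℓ
    a : X

-- Almost-full relations

infixl 6 _↑_

_↑_ : Rel X 0ℓ → X → Rel X 0ℓ
(R ↑ a) x y = R x y ⊎ R a x

data AlmostFull {X : Set} (R : Rel X 0ℓ) : Set₁ where
  now   : (∀ x y → R x y) → AlmostFull R
  later : (∀ a → AlmostFull (R ↑ a)) → AlmostFull R

Good : Rel X 0ℓ → (ℕ → X) → Set
Good R w = Σ ℕ λ i → Σ ℕ λ j → i < j × R (w i) (w j)

almostFull⇒good : AlmostFull R → ∀ w → Good R w
almostFull⇒good (now full) w = 0 , 1 , z<s , full (w 0) (w 1)
almostFull⇒good (later af) w with almostFull⇒good (af (w 0)) (w ∘ suc)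
... | i , j , i<j , inj₁ wi≤wj = suc i , suc j , s<s i<j , wi≤wj
... | i , j , i<j , inj₂ w0≤wi = 0 , suc i , z<s , w0≤wi

↑-dec : Decidable R → ∀ a → Decidable (R ↑ a)
↑-dec R? a x y = R? x y ⊎-dec R? a x

af-mono : R ⇒ S → AlmostFull R → AlmostFull S
af-mono R⇒S (now full)  = now λ x y → R⇒S (full x y)
af-mono R⇒S (later af) = later λ a → af-mono (Sum.map R⇒S R⇒S) (af a)

af-comap : (f : Y → X) → AlmostFull R → AlmostFull (R on f)
af-comap f (now full)  = now λ x y → full (f x) (f y)
af-comap f (later af) = later λ a → af-comap f (af (f a))

Branch : Pred X 0ℓ → Rel X 0ℓ → Rel X 0ℓ → Rel X 0ℓ
Branch P V U x y = (P x → V x y) × (¬ P x → U x y)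

module _ {P : Pred X 0ℓ} (P? : ∀ x → Dec (P x)) where

  branch-↑ᵛ : P a → Branch P (V ↑ a) U ⇒ Branch P V U ↑ a
  branch-↑ᵛ pa {x} (ifP , ifNotP) with P? x
  ... | no ¬px = inj₁ ((λ px → contradiction px ¬px) , ifNotP)
  ... | yes px with ifP px
  ...   | inj₁ vxy = inj₁ ((λ _ → vxy) , λ ¬px → contradiction px ¬px)
  ...   | inj₂ vax = inj₂ ((λ _ → vax) , λ ¬pa → contradiction pa ¬pa)

  branch-↑ᵘ : ¬ P a → Branch P V (U ↑ a) ⇒ Branch P V U ↑ a
  branch-↑ᵘ ¬pa {x} (ifP , ifNotP) with P? x
  ... | yes px = inj₁ (ifP , λ ¬px → contradiction px ¬px)
  ... | no ¬px with ifNotP ¬px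
  ...   | inj₁ uxy = inj₁ ((λ px → contradiction px ¬px) , λ _ → uxy)
  ...   | inj₂ uax = inj₂ ((λ pa → contradiction pa ¬pa) , λ _ → uax)

  mutual
    af-branch : AlmostFull V → AlmostFull U → AlmostFull (Branch P V U)
    af-branch (now V-full) (now U-full) = now λ x y → (λ _ → V-full x y) , (λ _ → U-full x y)
    af-branch afV afU = later λ a → af-branch-↑ afV afU (P? a)

    af-branch-↑ : AlmostFull V → AlmostFull U → Dec (P a) → AlmostFull (Branch P V U ↑ a)
    af-branch-↑ {a = a} (now V-full) afU (yes pa) =
      now λ x y → inj₂ ((λ _ → V-full a x) , λ ¬pa → contradiction pa ¬pa)
    af-branch-↑ {V = V} {U = U} (later afV) afU (yes pa) =
      af-mono (branch-↑ᵛ {V = V} {U = U} pa) (af-branch (afV _) afU)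
    af-branch-↑ {a = a} afV (now U-full) (no ¬pa) =
      now λ x y → inj₂ ((λ pa → contradiction pa ¬pa) , λ _ → U-full a x)
    af-branch-↑ {V = V} {U = U} afV (later afU) (no ¬pa) =
      af-mono (branch-↑ᵘ {V = V} {U = U} ¬pa) (af-branch afV (afU _))

-- Decide R a x at the left argument x: if it holds, it already supplies half of
-- (R ∩ S) a x and the induction proceeds on S; otherwise it proceeds on R.
af-∩ : Decidable R → AlmostFull R → AlmostFull S → AlmostFull (R ∩ S)
af-∩ R? (now R-full) afS = af-mono (λ s → R-full _ _ , s) afS
af-∩ R? afR@(later _) (now S-full) = af-mono (λ r → r , S-full _ _) afR
af-∩ {R = R} {S = S} R? (later afR) (later afS) = later λ a →
  af-mono (branch⇒∩↑ a)
    (af-branch (R? a) (af-∩ R? (later afR) (afS a)) (af-∩ (↑-dec R? a) (afR a) (later afS)))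
  where
  branch⇒∩↑ : ∀ a → Branch (R a) (R ∩ (S ↑ a)) ((R ↑ a) ∩ S) ⇒ (R ∩ S) ↑ a
  branch⇒∩↑ a {x} (ifR , ifNotR) with R? a x
  ... | yes rax with ifR rax
  ...   | rxy , inj₁ sxy = inj₁ (rxy , sxy)
  ...   | _   , inj₂ sax = inj₂ (rax , sax)
  branch⇒∩↑ a {x} (ifR , ifNotR) | no ¬rax with ifNotR ¬rax
  ...   | inj₁ rxy , sxy = inj₁ (rxy , sxy)
  ...   | inj₂ rax , _   = contradiction rax ¬rax

data WithBottom (R : Rel X 0ℓ) : Rel (Maybe X) 0ℓ where
  nothing : ∀ {y} → WithBottom R nothing y
  just    : ∀ {x y} → R x y → WithBottom R (just x) (just y)

withBottom? : Decidable R → Decidable (WithBottom R)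
withBottom? R? nothing  y        = yes nothing
withBottom? R? (just x) nothing  = no λ ()
withBottom? R? (just x) (just y) with R? x y
... | yes r  = yes (just r)
... | no ¬r = no λ { (just r) → ¬r r }

just≤when : ∀ b {x y} → WithBottom R (just x) (when b y) → T b × R x y
just≤when true (just r) = tt , r

when-T : ∀ {b} {x : X} → T b → when b x ≡ just x
when-T {b = true} _ = refl

af-withBottom : AlmostFull R → AlmostFull (WithBottom R)
af-withBottom (now full) = later λ
  { nothing  → now λ _ _ → inj₂ nothing
  ; (just a) → now λ { nothing _ → inj₁ nothing ; (just x) _ → inj₂ (just (full a x)) } }
af-withBottom {R = R} (later af) = later λ
  { nothing  → now λ _ _ → inj₂ nothing
  ; (just a) → af-mono withBottom-↑ (af-withBottom (af a)) }
  where
  withBottom-↑ : WithBottom (R ↑ a) ⇒ WithBottom R ↑ just a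
  withBottom-↑ nothing          = inj₁ nothing
  withBottom-↑ (just (inj₁ r)) = inj₁ (just r)
  withBottom-↑ (just (inj₂ r)) = inj₂ (just r)

pointwise? : Decidable R → ∀ {n} → Decidable (Pointwise R {n})
pointwise? R? xs ys = all? λ i → R? (xs i) (ys i)

af-pointwise : Decidable R → ∀ n → AlmostFull R → AlmostFull (Pointwise R {n})
af-pointwise R? zero    af = now λ _ _ ()
af-pointwise {R = R} R? (suc n) af =
  af-mono head∩tail⇒pointwise
    (af-∩ (λ xs ys → R? (head xs) (head ys))
          (af-comap head af) (af-comap tail (af-pointwise R? n af)))
  where
  head∩tail⇒pointwise : (R on head) ∩ (Pointwise R on tail) ⇒ Pointwise R {suc n}
  head∩tail⇒pointwise (r , rs) zero    = r
  head∩tail⇒pointwise (r , rs) (suc i) = rs i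

-- Higman's lemma

module _ {R : Rel X 0ℓ} (R? : Decidable R) where

  Cut : X → List X → Set
  Cut a u = FirstView (∁ (R a)) (R a) u ⊎ All (∁ (R a)) u

  cut : ∀ a u → Cut a u
  cut a = Sum.map₁ toView ∘ first (λ x → Sum.swap (toSum (R? a x)))

  prefix : ∀ {u} → Cut a u → List X
  prefix (inj₁ (_++_∷_ {xs = u₁} _ _ _)) = u₁
  prefix {u = u} (inj₂ _)                 = u

  rest : ∀ {u} → Cut a u → Maybe (X × List X)
  rest (inj₁ (_++_∷_ {y = x} _ _ u₂)) = just (x , u₂)
  rest (inj₂ _)                        = nothing

  -- Q a stands for the induction hypothesis Sublist (R ↑ a); abstracting it lets the case
  -- of a full R, where no such hypothesis is available, use Q a = everything.
  module _ (Q : X → Rel (List X) 0ℓ) (af-Q : ∀ a → AlmostFull (Q a))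
           (Q-sound : ∀ {a u v} → All (∁ (R a)) u → Q a u v → Sublist R u v)
           (af-R : AlmostFull R) where

    CutPoint≤ : List X → Rel (X × List X) 0ℓ
    CutPoint≤ w = (R on proj₁) ∩ ((Sublist R ↑ w) on proj₂)

    cuts⇒sublist↑ : ∀ {a w u v} (cu : Cut a u) (cv : Cut a v) →
                    WithBottom (CutPoint≤ w) (rest cu) (rest cv) →
                    Q a (prefix cu) (prefix cv) → (Sublist R ↑ (a ∷ w)) u v
    cuts⇒sublist↑ (inj₂ u-avoids) (inj₂ _) nothing q = inj₁ (Q-sound u-avoids q)
    cuts⇒sublist↑ (inj₂ u-avoids) (inj₁ (_ ++ _ ∷ v₂)) nothing q =
      inj₁ (++ʳ (_ ∷ v₂) (Q-sound u-avoids q))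
    cuts⇒sublist↑ (inj₁ (u-avoids ++ _ ∷ _)) (inj₁ (_ ++ _ ∷ _))
                  (just (rxy , inj₁ u₂⊆v₂)) q =
      inj₁ (++⁺ (Q-sound u-avoids q) (rxy ∷ u₂⊆v₂))
    cuts⇒sublist↑ (inj₁ (_++_∷_ {xs = u₁} _ rax _)) (inj₁ (_ ++ _ ∷ _))
                  (just (_ , inj₂ w⊆u₂)) q =
      inj₂ (++ˡ u₁ (rax ∷ w⊆u₂))

    -- Cut u and v at their first elements above a: the prefixes avoid a and are compared
    -- by Q a, the cut points by R, and the remainders by the induction hypothesis for w.
    af-sublist↑ : ∀ w → AlmostFull (Sublist R ↑ w)
    af-sublist↑ []      = now λ u _ → inj₂ (minimum u)
    af-sublist↑ (a ∷ w) =
      af-mono (λ {u} {v} (r , q) → cuts⇒sublist↑ (cut a u) (cut a v) r q)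
        (af-∩ (λ u v → withBottom? pair? (rest (cut a u)) (rest (cut a v)))
              (af-comap (rest ∘ cut a)
                 (af-withBottom (af-∩ (λ p q → R? (proj₁ p) (proj₁ q)) (af-comap proj₁ af-R)
                                      (af-comap proj₂ (af-sublist↑ w)))))
              (af-comap (prefix ∘ cut a) (af-Q a)))
      where
      pair? : Decidable (CutPoint≤ w)
      pair? p q = R? (proj₁ p) (proj₁ q) ×-dec ↑-dec (sublist? R?) w (proj₂ p) (proj₂ q)

higman : Decidable R → AlmostFull R → AlmostFull (Sublist R)
higman {R = R} R? af-R@(now R-full) =
  later (af-sublist↑ R? (λ _ _ _ → ⊤) (λ _ → now λ _ _ → tt) avoids-full af-R)
  where
  avoids-full : ∀ {a u v} → All (∁ (R a)) u → ⊤ → Sublist R u v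
  avoids-full []           _ = minimum _
  avoids-full (¬rax ∷ _) _ = contradiction (R-full _ _) ¬rax
higman {R = R} R? af-R@(later af-R↑) =
  later (af-sublist↑ R? (λ a → Sublist (R ↑ a)) (λ a → higman (↑-dec R? a) (af-R↑ a))
                     avoids-↑ af-R)
  where
  avoids-↑ : ∀ {a u v} → All (∁ (R a)) u → Sublist (R ↑ a) u v → Sublist R u v
  avoids-↑ u-avoids          []                = []
  avoids-↑ u-avoids          (y ∷ʳ u⊆v)       = y ∷ʳ avoids-↑ u-avoids u⊆v
  avoids-↑ (_ ∷ u-avoids)    (inj₁ rxy ∷ u⊆v) = rxy ∷ avoids-↑ u-avoids u⊆v
  avoids-↑ (¬rax ∷ _)        (inj₂ rax ∷ _)   = contradiction rax ¬rax

record IndexEmbedding {A B : Set} (R : REL A B 0ℓ) {m n} (a : Vector A m) (b : Vector B n) :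
                      Set where
  field
    to        : Fin m → Fin n
    injective : Injective _≡_ _≡_ to
    related   : ∀ i → R (a i) (b (to i))

open IndexEmbedding

tabulate-sublist⇒indexEmbedding : ∀ {R : REL A B 0ℓ} {m n} {a : Vector A m} {b : Vector B n} →
                                  Sublist R (tabulate a) (tabulate b) → IndexEmbedding R a b
tabulate-sublist⇒indexEmbedding {m = zero} _ =
  record { to = λ () ; injective = λ { {()} } ; related = λ () }
tabulate-sublist⇒indexEmbedding {m = suc m} {n = suc n} (_ ∷ʳ a⊆b) =
  record { to = suc ∘ to e ; injective = injective e ∘ Fin.suc-injective ; related = related e }
  where e = tabulate-sublist⇒indexEmbedding a⊆b
tabulate-sublist⇒indexEmbedding {m = suc m} {n = suc n} (r ∷ a⊆b) = record
  { to        = lift 1 (to e)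
  ; injective = lift-injective (to e) (injective e) 1
  ; related   = λ { zero → r ; (suc i) → related e i } }
  where e = tabulate-sublist⇒indexEmbedding a⊆b

fibrewise-injective : ∀ {C D : Set} (p : B → A) (q : C → D) (φ : A → D) (h : A → B → C) →
                      Injective _≡_ _≡_ φ → (∀ u → Injective _≡_ _≡_ (h u)) →
                      (∀ x → q (h (p x) x) ≡ φ (p x)) → Injective _≡_ _≡_ (λ x → h (p x) x)
fibrewise-injective p q φ h φ-inj h-inj over {x₁} {x₂} eq =
  h-inj (p x₂) (subst (λ u → h u x₁ ≡ h (p x₂) x₂) same-base eq)
  where
  open ≡-Reasoning
  same-base : p x₁ ≡ p x₂
  same-base = φ-inj (begin
    φ (p x₁)         ≡⟨ sym (over x₁) ⟩
    q (h (p x₁) x₁) ≡⟨ cong q eq ⟩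
    q (h (p x₂) x₂) ≡⟨ over x₂ ⟩
    φ (p x₂)         ∎)

module Structures (Σ' : Signature) where

  Sort : Set
  Sort = Fin (nSorts Σ')

  Fun : Set
  Fun = Fin (nFuns Σ')

  private
    variable
      j j' k n : ℕ
      s : Sort
      f : Fun

  data Walk : ℕ → Sort → Set where
    []  : Walk 0 s
    _∷_ : ∀ f → Walk k (cod Σ' f) → Walk (suc k) (dom Σ' f)

  vertex : Walk k s → Fin (suc k) → Sort
  vertex {s = s} w       zero    = s
  vertex         (f ∷ w) (suc i) = vertex w i

  walk-path⁺ : (w : Walk k s) {i i' : Fin (suc k)} → toℕ i < toℕ i' →
               Path⁺ Σ' (vertex w i) (vertex w i')
  walk-path⁺ (f ∷ w) {zero}  {suc zero}     _         = edge f
  walk-path⁺ (f ∷ w) {zero}  {suc (suc i')} _         = f ∷ walk-path⁺ w {zero} {suc i'} z<s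
  walk-path⁺ (f ∷ w) {suc i} {suc i'}       (s<s i<i') = walk-path⁺ w i<i'

  acyclic⇒no-long-walk : Acyclic Σ' → ¬ Walk (nSorts Σ') s
  acyclic⇒no-long-walk acyclic w with pigeonhole (n<1+n (nSorts Σ')) (vertex w)
  ... | i , i' , i<i' , same =
    acyclic _ (subst (λ t → Path⁺ Σ' t (vertex w i')) same (walk-path⁺ w i<i'))

  IsRoot : Sort → Set
  IsRoot s = ∀ f → dom Σ' f ≢ s

  data Ascent : ℕ → Sort → Set where
    root : IsRoot s → Ascent 0 s
    step : ∀ f → Ascent n (cod Σ' f) → Ascent (suc n) (dom Σ' f)

  climb : ∀ k s → Walk k s ⊎ ∃ λ n → n ≤ k × Ascent n s
  climb zero    s = inj₁ []
  climb (suc k) s with any? (λ f → dom Σ' f ≟ s)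
  ... | no ¬out       = inj₂ (0 , z≤n , root λ f p → ¬out (f , p))
  ... | yes (f , refl) =
    Sum.map (f ∷_) (λ (n , n≤k , a) → suc n , s≤s n≤k , step f a) (climb k (cod Σ' f))

  D : ℕ
  D = nSorts Σ'

  -- Chain j s: s lies D ∸ j steps below a root. The index j is the depth of the codes
  -- compared at s, which decreases by one per step down from the roots. The equation in
  -- step, rather than the index dom Σ' f, lets two chains at one sort be matched together.
  data Chain : ℕ → Sort → Set where
    root : IsRoot s → Chain D s
    step : ∀ f → dom Σ' f ≡ s → Chain (suc j) (cod Σ' f) → Chain j s

  ascent⇒chain : Ascent n s → n + j ≡ D → Chain j s
  ascent⇒chain (root r)   refl = root r
  ascent⇒chain (step f a) e    = step f refl (ascent⇒chain a (trans (+-suc _ _) e))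

  chain : Acyclic Σ' → ∀ s → ∃ λ j → Chain j s
  chain acyclic s with climb D s
  ... | inj₁ w              = contradiction w (acyclic⇒no-long-walk acyclic)
  ... | inj₂ (n , n≤D , a) = D ∸ n , ascent⇒chain a (m+[n∸m]≡n n≤D)

  module _ (oneOut : AtMostOneOut Σ') where

    chain-height-unique : Chain j s → Chain j' s → j ≡ j'
    chain-height-unique (root _)     (root _)      = refl
    chain-height-unique (root r)     (step f p _)  = contradiction p (r f)
    chain-height-unique (step f p _) (root r)      = contradiction p (r f)
    chain-height-unique (step f p c) (step g q c') with oneOut f g (trans p (sym q))
    ... | refl = suc-injective (chain-height-unique c c')

    chain-parent : Chain j (dom Σ' f) → Chain (suc j) (cod Σ' f)
    chain-parent {f = f} (root r) = contradiction refl (r f)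
    chain-parent {f = f} (step g p c) with oneOut g f p
    ... | refl = c

  Code : ℕ → Set
  Code zero    = ⊤
  Code (suc k) = Vector (List (Maybe (Code k))) (nFuns Σ')

  Code≤ : ∀ k → Rel (Code k) 0ℓ
  Code≤ zero    _ _ = ⊤
  Code≤ (suc k)     = Pointwise (Sublist (WithBottom (Code≤ k)))

  code≤? : ∀ k → Decidable (Code≤ k)
  code≤? zero    _ _ = yes tt
  code≤? (suc k)     = pointwise? (sublist? (withBottom? (code≤? k)))

  af-code≤ : ∀ k → AlmostFull (Code≤ k)
  af-code≤ zero    = now λ _ _ → tt
  af-code≤ (suc k) = af-pointwise (sublist? (withBottom? (code≤? k))) (nFuns Σ')
                       (higman (withBottom? (code≤? k)) (af-withBottom (af-code≤ k)))

  -- Non-children of x are kept as nothing rather than filtered out, so that positions stay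
  -- aligned with Fin (size M (dom f)) and a sublist embedding of child lists reads back as
  -- an injective map on the whole sort. Comparing through toℕ lets this typecheck for
  -- every f; for cod f ≢ s the entries are junk that is never read back.
  mutual
    code : (M : FinStructure Σ') → ∀ k s → Fin (size M s) → Code k
    code M zero    s x   = tt
    code M (suc k) s x f = tabulate (childCode M k f x)

    childCode : (M : FinStructure Σ') → ∀ k f →
                Fin (size M s) → Fin (size M (dom Σ' f)) → Maybe (Code k)
    childCode M k f x z = when (toℕ (op M f z) ≡ᵇ toℕ x) (code M k (dom Σ' f) z)

  childCode-parent : (M : FinStructure Σ') → ∀ k f z →
                     childCode M k f (op M f z) z ≡ just (code M k (dom Σ' f) z)
  childCode-parent M k f z = when-T (≡⇒≡ᵇ (toℕ (op M f z)) _ refl)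

  profile : FinStructure Σ' → Vector (List (Code D)) (nSorts Σ')
  profile M s = tabulate (code M D s)

  Profile≤ : Rel (FinStructure Σ') 0ℓ
  Profile≤ = Pointwise (Sublist (Code≤ D)) on profile

  af-profile≤ : AlmostFull Profile≤
  af-profile≤ = af-comap profile
    (af-pointwise (sublist? (code≤? D)) (nSorts Σ') (higman (code≤? D) (af-code≤ D)))

  module Decode (M N : FinStructure Σ') (M≤N : Profile≤ M N) where

    Match : ∀ j s → Fin (size M s) → Set
    Match j s x = Σ (Fin (size N s)) λ y → Code≤ j (code M j s x) (code N j s y)

    rootEmbedding : ∀ s → IndexEmbedding (Code≤ D) (code M D s) (code N D s)
    rootEmbedding s = tabulate-sublist⇒indexEmbedding (M≤N s)

    childEmbedding : ∀ f {u v} →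
                     Code≤ (suc k) (code M (suc k) (cod Σ' f) u) (code N (suc k) (cod Σ' f) v) →
                     IndexEmbedding (WithBottom (Code≤ k)) (childCode M k f u) (childCode N k f v)
    childEmbedding f u≤v = tabulate-sublist⇒indexEmbedding (u≤v f)

    child-related : ∀ f {z z' v} →
                    WithBottom (Code≤ k) (childCode M k f (op M f z) z) (childCode N k f v z') →
                    op N f z' ≡ v × Code≤ k (code M k (dom Σ' f) z) (code N k (dom Σ' f) z')
    child-related {k = k} f {z} {z'} {v} r
      with just≤when (toℕ (op N f z') ≡ᵇ toℕ v)
             (subst (λ e → WithBottom (Code≤ k) e (childCode N k f v z'))
                    (childCode-parent M k f z) r)
    ... | parent , z≤z' = toℕ-injective (≡ᵇ⇒≡ _ _ parent) , z≤z'

    descend : ∀ f {x} → Match (suc j) (cod Σ' f) (op M f x) → Match j (dom Σ' f) x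
    descend f {x} (_ , u≤v) = to e x , proj₂ (child-related f (related e x))
      where e = childEmbedding f u≤v

    descend-parent : ∀ f {x} (m : Match (suc j) (cod Σ' f) (op M f x)) →
                     op N f (proj₁ (descend f m)) ≡ proj₁ m
    descend-parent f {x} (_ , u≤v) = proj₁ (child-related f (related (childEmbedding f u≤v) x))

    mapChain : Chain j s → ∀ x → Match j s x
    mapChain (root {s = s} _)  x = to (rootEmbedding s) x , related (rootEmbedding s) x
    mapChain (step f refl c) x = descend f (mapChain c (op M f x))

    mapChain-injective : (c : Chain j s) → Injective _≡_ _≡_ (proj₁ ∘ mapChain c)
    mapChain-injective (root {s = s} _)  = injective (rootEmbedding s)
    mapChain-injective {j = j} (step f refl c) =
      fibrewise-injective (op M f) (op N f) (proj₁ ∘ mapChain c) (to ∘ children)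
        (mapChain-injective c) (injective ∘ children)
        (λ x → descend-parent f (mapChain c (op M f x)))
      where
      children : ∀ u → IndexEmbedding (WithBottom (Code≤ j))
                                      (childCode M j f u) (childCode N j f (proj₁ (mapChain c u)))
      children u = childEmbedding f (proj₂ (mapChain c u))

    module _ (oneOut : AtMostOneOut Σ') where

      mapChain-irrelevant : (c c' : Chain j s) → ∀ x → mapChain c x ≡ mapChain c' x
      mapChain-irrelevant (root _)        (root _)     x = refl
      mapChain-irrelevant (root r)        (step f p _) x = contradiction p (r f)
      mapChain-irrelevant (step f p _)    (root r)     x = contradiction p (r f)
      mapChain-irrelevant (step f refl c) (step g q c') x with oneOut f g (sym q)
      mapChain-irrelevant (step f refl c) (step f refl c') x | refl =
        cong (descend f) (mapChain-irrelevant c c' (op M f x))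

      mapChain-unique : (c : Chain j s) (c' : Chain j' s) → ∀ x →
                        proj₁ (mapChain c x) ≡ proj₁ (mapChain c' x)
      mapChain-unique c c' x with chain-height-unique oneOut c c'
      ... | refl = cong proj₁ (mapChain-irrelevant c c' x)

      mapChain-parent : (c : Chain j (dom Σ' f)) → ∀ x →
                        op N f (proj₁ (mapChain c x))
                          ≡ proj₁ (mapChain (chain-parent oneOut c) (op M f x))
      mapChain-parent {f = f} (root r) x = contradiction refl (r f)
      mapChain-parent {f = f} (step g p c) x with oneOut g f p
      mapChain-parent (step f refl c) x | refl = descend-parent f (mapChain c (op M f x))

      mapChain-commutes : (c : Chain j (dom Σ' f)) (c' : Chain j' (cod Σ' f)) → ∀ x →
                          proj₁ (mapChain c' (op M f x)) ≡ op N f (proj₁ (mapChain c x))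
      mapChain-commutes {f = f} c c' x =
        trans (mapChain-unique c' (chain-parent oneOut c) (op M f x)) (sym (mapChain-parent c x))

      embedding : Acyclic Σ' → Embedding M N
      embedding acyclic = record
        { map       = embed
        ; injective = λ s → mapChain-injective (proj₂ (chain acyclic s))
        ; commutes  = embed-commutes }
        where
        embed : ∀ s → Fin (size M s) → Fin (size N s)
        embed s = proj₁ ∘ mapChain (proj₂ (chain acyclic s))

        embed-commutes : ∀ f x → embed (cod Σ' f) (op M f x) ≡ op N f (embed (dom Σ' f) x)
        embed-commutes f x =
          mapChain-commutes (proj₂ (chain acyclic (dom Σ' f))) (proj₂ (chain acyclic (cod Σ' f))) x

  profile≤⇒embedding : Acyclic Σ' → AtMostOneOut Σ' → Profile≤ ⇒ Embedding
  profile≤⇒embedding acyclic oneOut {M} {N} M≤N = Decode.embedding M N M≤N oneOut acyclic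

propositionE6 : (Σ' : Signature) → TreeLike Σ' → EmbeddabilityWQO Σ'
propositionE6 Σ' (acyclic , oneOut) =
  almostFull⇒good (af-mono (profile≤⇒embedding acyclic oneOut) af-profile≤)
  where open Structures Σ'
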